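{- Let $\lambda$ be a nonzero real number and let $\alpha,n$ be nonnegative integers with $n\ge\alpha$. Then $$ \alpha!{n \brace \alpha}_{ -\lambda}=\sum_{j=\alpha}^{n}(-1)^{n-j}j!{n \brace j}_{\lambda}\binom{j-1}{\alpha-1}. $$
   Context: For a real parameter $\mu$ the degenerate falling factorials are $(x)_{0,\mu}=1$ and $(x)_{n,\mu}=x(x-\mu)\cdots(x-(n-1)\mu)$ for $n\ge1$; $(x)_n=(x)_{n,1}$ is the usual falling factorial. The degenerate Stirling numbers of the second kind ${n \brace k}_{\mu}$ are defined by $(x)_{n,\mu}=\sum_{k=0}^{n}{n \brace k}_{\mu}(x)_k$ (so ${n\brace k}_{ -\lambda}$ is obtained with $\mu=-\lambda$). Binomial coefficients are $\binom{x}{m}=(x)_m/m!$ for integers $m\ge0$. For $0\le\alpha\le j$, the symbol $\binom{j-1}{\alpha-1}$ is understood as $\binom{j-1}{j-\alpha}$ (this agrees with the usual value when $j\ge1$, and gives $\binom{ -1}{ -1}=1$). -}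

module Defs where

open import Level using (Level)
open import Data.Nat using (ℕ; zero; suc; _∸_)
open import Data.Nat.Combinatorics using (_C_)
open import Algebra.Bundles using (CommutativeRing)

module _ {c ℓ : Level} (R : CommutativeRing c ℓ) where
  open CommutativeRing R using (Carrier; 0#; 1#; _+_; _*_; -_; _-_)

  ι : ℕ → Carrier
  ι zero    = 0#
  ι (suc n) = 1# + ι n

  sgn : ℕ → Carrier
  sgn zero    = 1#
  sgn (suc n) = - sgn n

  sumFrom : ℕ → ℕ → (ℕ → Carrier) → Carrier
  sumFrom a zero    f = 0#
  sumFrom a (suc m) f = f a + sumFrom (suc a) m f

  -- Degenerate Stirling numbers of the second kind {n brace k}_μ,
  -- the coefficients in (x)_{n,μ} = Σ_k S(n,k) (x)_k.  Since
  -- (x)_{n+1,μ} = (x)_{n,μ} (x - nμ) and (x)_k (x - nμ) = (x)_{k+1} + (k - nμ)(x)_k,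
  -- they are given by the recurrence below.
  dStirling : Carrier → ℕ → ℕ → Carrier
  dStirling μ zero    zero    = 1#
  dStirling μ zero    (suc k) = 0#
  dStirling μ (suc n) zero    = - (ι n * μ) * dStirling μ n zero
  dStirling μ (suc n) (suc k) =
    dStirling μ n k + (ι (suc k) - ι n * μ) * dStirling μ n (suc k)

-- binom(j-1, α-1), read as binom(j-1, j-α) (for 0 ≤ α ≤ j), so binom(-1,-1) = 1
binomShift : ℕ → ℕ → ℕ
binomShift zero    α = 1
binomShift (suc m) α = m C (suc m ∸ α)

-- (x)_{n,−λ} = (−1)ⁿ (−x)_{n,λ} = (−1)ⁿ Σⱼ S_λ(n,j) (−x)ⱼ, and (−x)ⱼ = (−1)ʲ Σₖ L(j,k) (x)ₖ with the
-- unsigned Lah numbers L(j,k). Hence S_{−λ}(n,k) = Σⱼ (−1)ⁿ⁻ʲ S_λ(n,j) L(j,k), and the theorem follows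
-- from k! L(j,k) = j! C(j−1,k−1). Without polynomials to compare, the middle identity is proved on
-- coefficient sequences by induction on n: p(x) ↦ (−1)ⁿ p(−x) turns multiplication by x + c into
-- multiplication by x − c.

{-# OPTIONS --safe #-}
module Submission where

open import Defs
open import Level using (Level)
open import Data.Nat using (ℕ; _≤_; _∸_; suc)
open import Data.Nat using (_!)
open import Algebra.Bundles using (CommutativeRing)
open import Relation.Nullary using (¬_)

open import Data.Nat as ℕ using (zero; z<s)
import Data.Nat.Properties as ℕₚ
open import Function using (_∘_)
open import Relation.Binary.PropositionalEquality as ≡ using (_≡_)
import Relation.Binary.Reasoning.Setoid as SetoidReasoning

cons : ∀ {a} {A : Set a} → A → (ℕ → A) → ℕ → A
cons z f zero    = z
cons z f (suc k) = f k

module _ where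
  open import Data.Nat using (_+_; _*_; _<_; s≤s)
  open import Data.Nat.Properties
    using (*-zeroʳ; +-∸-assoc; m+n∸m≡n; m≤m+n; n<1+n; m<n⇒m<1+n; m≤n⇒m<n∨m≡n; m≤n⇒∃[o]m+o≡n;
           n∸n≡0; +-cancelʳ-≡; *-distribʳ-+)
  open import Data.Nat.Combinatorics using (_C_; nC1≡n; nCk+nC[k+1]≡[n+1]C[k+1])
  open import Data.Nat.Combinatorics.Specification using (k>n⇒nCk≡0)
  open import Data.Nat.Tactic.RingSolver using (solve-∀)
  open import Data.Product using (_,_)
  open import Data.Sum using (inj₁; inj₂)
  open ≡ using (refl; sym; trans; cong; cong₂)
  open ≡.≡-Reasoning

  -- x (x + 1) ⋯ (x + j − 1) = Σₖ lah j k (x)ₖ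
  lah : ℕ → ℕ → ℕ
  lah zero    zero    = 1
  lah zero    (suc k) = 0
  lah (suc j) k       = cons 0 (lah j) k + (j + k) * lah j k

  lah-suc-zero : ∀ j → lah (suc j) zero ≡ 0
  lah-suc-zero zero    = refl
  lah-suc-zero (suc j) = trans (cong ((suc j + 0) *_) (lah-suc-zero j)) (*-zeroʳ (suc j + 0))

  lah-above : ∀ {j k} → j < k → lah j k ≡ 0
  lah-above {zero}  {suc k} _         = refl
  lah-above {suc j} {suc k} (s≤s j<k) =
    trans (cong₂ (λ x y → x + (j + suc k) * y) (lah-above j<k) (lah-above (m<n⇒m<1+n j<k)))
          (*-zeroʳ (j + suc k))

  lah-diag : ∀ j → lah j j ≡ 1
  lah-diag zero    = refl
  lah-diag (suc j) =
    trans (cong₂ (λ x y → x + (j + suc j) * y) (lah-diag j) (lah-above (n<1+n j)))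
          (cong suc (*-zeroʳ (j + suc j)))

  [1+k]*nC[1+k]+k*nCk≡n*nCk : ∀ n k → suc k * (n C suc k) + k * (n C k) ≡ n * (n C k)
  [1+k]*nC[1+k]+k*nCk≡n*nCk zero    zero    = refl
  [1+k]*nC[1+k]+k*nCk≡n*nCk zero    (suc k) = cong₂ _+_ (*-zeroʳ (suc (suc k))) (*-zeroʳ (suc k))
  [1+k]*nC[1+k]+k*nCk≡n*nCk (suc n) zero    = begin
    1 * (suc n C 1) + 0 * 1 ≡⟨ cong (λ x → 1 * x + 0 * 1) (nC1≡n (suc n)) ⟩
    1 * suc n + 0 * 1       ≡⟨ unit (suc n) ⟩
    suc n * 1               ∎
    where
    unit : ∀ m → 1 * m + 0 * 1 ≡ m * 1
    unit = solve-∀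
  [1+k]*nC[1+k]+k*nCk≡n*nCk (suc n) (suc k) = begin
    suc (suc k) * (suc n C suc (suc k)) + suc k * (suc n C suc k)
      ≡⟨ cong₂ (λ x y → suc (suc k) * x + suc k * y)
               (nCk+nC[k+1]≡[n+1]C[k+1] n (suc k)) (nCk+nC[k+1]≡[n+1]C[k+1] n k) ⟨
    suc (suc k) * (b₁ + b₂) + suc k * (b₀ + b₁)
      ≡⟨ regroup k b₀ b₁ b₂ ⟩
    (suc (suc k) * b₂ + suc k * b₁) + b₁ + ((suc k * b₁ + k * b₀) + b₀)
      ≡⟨ cong₂ (λ x y → x + b₁ + (y + b₀))
               ([1+k]*nC[1+k]+k*nCk≡n*nCk n (suc k)) ([1+k]*nC[1+k]+k*nCk≡n*nCk n k) ⟩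
    n * b₁ + b₁ + (n * b₀ + b₀)
      ≡⟨ collect n b₀ b₁ ⟩
    suc n * (b₀ + b₁)
      ≡⟨ cong (suc n *_) (nCk+nC[k+1]≡[n+1]C[k+1] n k) ⟩
    suc n * (suc n C suc k) ∎
    where
    b₀ = n C k
    b₁ = n C suc k
    b₂ = n C suc (suc k)
    regroup : ∀ k b₀ b₁ b₂ → suc (suc k) * (b₁ + b₂) + suc k * (b₀ + b₁)
                           ≡ (suc (suc k) * b₂ + suc k * b₁) + b₁ + ((suc k * b₁ + k * b₀) + b₀)
    regroup = solve-∀
    collect : ∀ n b₀ b₁ → n * b₁ + b₁ + (n * b₀ + b₀) ≡ suc n * (b₀ + b₁)
    collect = solve-∀

  [1+d]*[k+d]C[1+d]≡k*[k+d]Cd : ∀ k d → suc d * ((k + d) C suc d) ≡ k * ((k + d) C d)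
  [1+d]*[k+d]C[1+d]≡k*[k+d]Cd k d = +-cancelʳ-≡ (d * ((k + d) C d)) _ _
    (trans ([1+k]*nC[1+k]+k*nCk≡n*nCk (k + d) d) (*-distribʳ-+ ((k + d) C d) k d))

  binomShift-diag : ∀ j → binomShift j j ≡ 1
  binomShift-diag zero    = refl
  binomShift-diag (suc j) = cong (j C_) (n∸n≡0 j)

  binomShift-rec : ∀ {j k} → k < j →
    suc k * binomShift j k + (j + suc k) * binomShift j (suc k) ≡ suc j * binomShift (suc j) (suc k)
  binomShift-rec {j} {k} k<j with m≤n⇒∃[o]m+o≡n k<j
  ... | d , refl = begin
    suc k * ((k + d) C (suc (k + d) ∸ k)) + (suc (k + d) + suc k) * ((k + d) C (k + d ∸ k))
      ≡⟨ cong₂ (λ x y → suc k * ((k + d) C x) + (suc (k + d) + suc k) * ((k + d) C y))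
               1+[k+d]∸k≡1+d (m+n∸m≡n k d) ⟩
    suc k * B + (suc (k + d) + suc k) * A
      ≡⟨ regroup k d A B ⟩
    suc k * B + (suc (suc (k + d)) * A + k * A)
      ≡⟨ cong (λ x → suc k * B + (suc (suc (k + d)) * A + x)) ([1+d]*[k+d]C[1+d]≡k*[k+d]Cd k d) ⟨
    suc k * B + (suc (suc (k + d)) * A + suc d * B)
      ≡⟨ collect k d A B ⟩
    suc (suc (k + d)) * (A + B)
      ≡⟨ cong (suc (suc (k + d)) *_) (nCk+nC[k+1]≡[n+1]C[k+1] (k + d) d) ⟩
    suc (suc (k + d)) * (suc (k + d) C suc d)
      ≡⟨ cong (λ x → suc (suc (k + d)) * (suc (k + d) C x)) 1+[k+d]∸k≡1+d ⟨
    suc (suc (k + d)) * (suc (k + d) C (suc (k + d) ∸ k)) ∎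
    where
    A = (k + d) C d
    B = (k + d) C suc d
    1+[k+d]∸k≡1+d : suc (k + d) ∸ k ≡ suc d
    1+[k+d]∸k≡1+d = trans (+-∸-assoc 1 (m≤m+n k d)) (cong suc (m+n∸m≡n k d))
    regroup : ∀ k d a b → suc k * b + (suc (k + d) + suc k) * a
                        ≡ suc k * b + (suc (suc (k + d)) * a + k * a)
    regroup = solve-∀
    collect : ∀ k d a b → suc k * b + (suc (suc (k + d)) * a + suc d * b)
                        ≡ suc (suc (k + d)) * (a + b)
    collect = solve-∀

  lah-closed : ∀ {j k} → k ≤ j → k ! * lah j k ≡ j ! * binomShift j k
  lah-closed {zero}  {zero} _ = refl
  lah-closed {suc j} {zero} _ = begin
    1 * lah (suc j) 0       ≡⟨ cong (1 *_) (lah-suc-zero j) ⟩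
    0                       ≡⟨ *-zeroʳ (suc j !) ⟨
    suc j ! * 0             ≡⟨ cong (suc j ! *_) (k>n⇒nCk≡0 (n<1+n j)) ⟨
    suc j ! * (j C suc j)   ∎
  lah-closed {suc j} {suc k} (s≤s k≤j) with m≤n⇒m<n∨m≡n k≤j
  ... | inj₂ refl = cong (suc k ! *_) (trans (lah-diag (suc k)) (sym (binomShift-diag (suc k))))
  ... | inj₁ k<j  = begin
    suc k ! * (lah j k + (j + suc k) * lah j (suc k))
      ≡⟨ expand (suc k) (k !) (lah j k) (j + suc k) (lah j (suc k)) ⟩
    suc k * (k ! * lah j k) + (j + suc k) * (suc k ! * lah j (suc k))
      ≡⟨ cong₂ (λ x y → suc k * x + (j + suc k) * y) (lah-closed k≤j) (lah-closed k<j) ⟩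
    suc k * (j ! * binomShift j k) + (j + suc k) * (j ! * binomShift j (suc k))
      ≡⟨ factor (suc k) (j !) (binomShift j k) (j + suc k) (binomShift j (suc k)) ⟩
    j ! * (suc k * binomShift j k + (j + suc k) * binomShift j (suc k))
      ≡⟨ cong (j ! *_) (binomShift-rec k<j) ⟩
    j ! * (suc j * binomShift (suc j) (suc k))
      ≡⟨ reorder (j !) (suc j) (binomShift (suc j) (suc k)) ⟩
    suc j ! * binomShift (suc j) (suc k) ∎
    where
    expand : ∀ m f a i b → m * f * (a + i * b) ≡ m * (f * a) + i * (m * f * b)
    expand = solve-∀
    factor : ∀ m f a i b → m * (f * a) + i * (f * b) ≡ f * (m * a + i * b)
    factor = solve-∀
    reorder : ∀ f m b → f * (m * b) ≡ m * f * b
    reorder = solve-∀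

module _ {c ℓ : Level} (R : CommutativeRing c ℓ) where
  open CommutativeRing R hiding (zero)
  open import Algebra.Properties.Ring ring using (-‿distribˡ-*; -‿distribʳ-*)
  open import Algebra.Properties.AbelianGroup +-abelianGroup using (⁻¹-∙-comm; xyx⁻¹≈y)
  open import Algebra.Properties.CommutativeSemigroup *-commutativeSemigroup
    using (x∙yz≈y∙xz) renaming (interchange to *-interchange)
  open import Algebra.Properties.CommutativeSemigroup +-commutativeSemigroup
    using () renaming (interchange to +-interchange)
  open import Algebra.Properties.Semiring.Mult semiring using (_×_; ×-homo-+; ×1-homo-*)
  open import Relation.Binary.Reasoning.Setoid setoid

  ι≡×1# : ∀ n → ι R n ≡ n × 1#
  ι≡×1# zero    = ≡.refl
  ι≡×1# (suc n) = ≡.cong (1# +_) (ι≡×1# n)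

  ι-+ : ∀ m n → ι R (m ℕ.+ n) ≈ ι R m + ι R n
  ι-+ m n rewrite ι≡×1# (m ℕ.+ n) | ι≡×1# m | ι≡×1# n = ×-homo-+ 1# m n

  ι-* : ∀ m n → ι R (m ℕ.* n) ≈ ι R m * ι R n
  ι-* m n rewrite ι≡×1# (m ℕ.* n) | ι≡×1# m | ι≡×1# n = ×1-homo-* m n

  ι-cons : ∀ f k → ι R (cons 0 f k) ≡ cons 0# (ι R ∘ f) k
  ι-cons f zero    = ≡.refl
  ι-cons f (suc k) = ≡.refl

  sumFrom-cong : ∀ {a} m {f g : ℕ → Carrier} → (∀ j → f j ≈ g j) → sumFrom R a m f ≈ sumFrom R a m g
  sumFrom-cong zero    f≈g = refl
  sumFrom-cong (suc m) f≈g = +-cong (f≈g _) (sumFrom-cong m f≈g)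

  sumFrom-cong-≤< : ∀ {a} m {f g : ℕ → Carrier} → (∀ j → a ≤ j → j ℕ.< a ℕ.+ m → f j ≈ g j) →
                    sumFrom R a m f ≈ sumFrom R a m g
  sumFrom-cong-≤<     zero    f≈g = refl
  sumFrom-cong-≤< {a} (suc m) f≈g = +-cong (f≈g a ℕₚ.≤-refl (ℕₚ.m<m+n a z<s)) (sumFrom-cong-≤< m
    (λ j a<j j<a+m → f≈g j (ℕₚ.<⇒≤ a<j) (≡.subst (j ℕ.<_) (≡.sym (ℕₚ.+-suc a m)) j<a+m)))

  sumFrom-+ : ∀ {a} m (f g : ℕ → Carrier) →
              sumFrom R a m (λ j → f j + g j) ≈ sumFrom R a m f + sumFrom R a m g
  sumFrom-+ zero    f g = sym (+-identityˡ 0#)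
  sumFrom-+ (suc m) f g = trans (+-congˡ (sumFrom-+ m f g)) (+-interchange _ _ _ _)

  sumFrom-*ˡ : ∀ {a} m x (f : ℕ → Carrier) → sumFrom R a m (λ j → x * f j) ≈ x * sumFrom R a m f
  sumFrom-*ˡ zero    x f = sym (zeroʳ x)
  sumFrom-*ˡ (suc m) x f = trans (+-congˡ (sumFrom-*ˡ m x f)) (sym (distribˡ x _ _))

  sumFrom-zero : ∀ {a} m {f : ℕ → Carrier} → (∀ j → f j ≈ 0#) → sumFrom R a m f ≈ 0#
  sumFrom-zero zero    f≈0 = refl
  sumFrom-zero (suc m) f≈0 = trans (+-cong (f≈0 _) (sumFrom-zero m f≈0)) (+-identityˡ 0#)

  sumFrom-suc : ∀ a m (f : ℕ → Carrier) → sumFrom R (suc a) m f ≡ sumFrom R a m (f ∘ suc)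
  sumFrom-suc a zero    f = ≡.refl
  sumFrom-suc a (suc m) f = ≡.cong (f (suc a) +_) (sumFrom-suc (suc a) m f)

  sumFrom-dropLast : ∀ a m {f : ℕ → Carrier} → f (a ℕ.+ m) ≈ 0# →
                     sumFrom R a (suc m) f ≈ sumFrom R a m f
  sumFrom-dropLast a zero    {f} f≈0 =
    trans (+-identityʳ _) (≡.subst (λ i → f i ≈ 0#) (ℕₚ.+-identityʳ a) f≈0)
  sumFrom-dropLast a (suc m) {f} f≈0 =
    +-congˡ (sumFrom-dropLast (suc a) m (≡.subst (λ i → f i ≈ 0#) (ℕₚ.+-suc a m) f≈0))

  sumFrom-dropFirst : ∀ {a} k {m} {f : ℕ → Carrier} → (∀ j → j ℕ.< a ℕ.+ k → f j ≈ 0#) →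
                      sumFrom R a (k ℕ.+ m) f ≈ sumFrom R (a ℕ.+ k) m f
  sumFrom-dropFirst {a} zero    {m} {f} _   =
    reflexive (≡.cong (λ b → sumFrom R b m f) (≡.sym (ℕₚ.+-identityʳ a)))
  sumFrom-dropFirst {a} (suc k) {m} {f} f≈0 = begin
    f a + sumFrom R (suc a) (k ℕ.+ m) f  ≈⟨ +-cong (f≈0 a (ℕₚ.m<m+n a z<s)) (sumFrom-dropFirst k f≈0′) ⟩
    0# + sumFrom R (suc a ℕ.+ k) m f     ≈⟨ +-identityˡ _ ⟩
    sumFrom R (suc (a ℕ.+ k)) m f        ≡⟨ ≡.cong (λ b → sumFrom R b m f) (ℕₚ.+-suc a k) ⟨
    sumFrom R (a ℕ.+ suc k) m f          ∎
    where
    f≈0′ : ∀ j → j ℕ.< suc a ℕ.+ k → f j ≈ 0#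
    f≈0′ j j< = f≈0 j (≡.subst (j ℕ.<_) (≡.sym (ℕₚ.+-suc a k)) j<)

  -- A sequence a stands for the polynomial p(x) = Σₖ a k (x)ₖ. Then mulLinear c a stands for (x + c) p(x),
  -- as (x)ₖ (x + c) = (x)ₖ₊₁ + (k + c) (x)ₖ, and when deg p ≤ n, reflect n a stands for (−1)ⁿ p(−x).
  mulLinear : Carrier → (ℕ → Carrier) → ℕ → Carrier
  mulLinear c a k = cons 0# a k + (ι R k + c) * a k

  reflect : ℕ → (ℕ → Carrier) → ℕ → Carrier
  reflect n a k = sumFrom R 0 (suc n) (λ j → sgn R (n ∸ j) * a j * ι R (lah j k))

  mulLinear-cong : ∀ {c d a b} → c ≈ d → (∀ k → a k ≈ b k) → ∀ k → mulLinear c a k ≈ mulLinear d b k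
  mulLinear-cong c≈d a≈b zero    = +-congˡ (*-cong (+-congˡ c≈d) (a≈b 0))
  mulLinear-cong c≈d a≈b (suc k) = +-cong (a≈b k) (*-cong (+-congˡ c≈d) (a≈b (suc k)))

  reflect-cong : ∀ n {a b} → (∀ j → a j ≈ b j) → ∀ k → reflect n a k ≈ reflect n b k
  reflect-cong n a≈b k = sumFrom-cong (suc n) (λ j → *-congʳ (*-congˡ (a≈b j)))

  dStirling-suc : ∀ μ n k → dStirling R μ (suc n) k ≈ mulLinear (- (ι R n * μ)) (dStirling R μ n) k
  dStirling-suc μ n zero    = sym (trans (+-identityˡ _) (*-congʳ (+-identityˡ _)))
  dStirling-suc μ n (suc k) = refl

  dStirling-above : ∀ μ {n k} → n ℕ.< k → dStirling R μ n k ≈ 0#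
  dStirling-above μ {zero}  {suc k} _           = refl
  dStirling-above μ {suc n} {suc k} (ℕ.s≤s n<k) =
    trans (+-cong (dStirling-above μ n<k)
                  (trans (*-congˡ (dStirling-above μ (ℕₚ.m<n⇒m<1+n n<k))) (zeroʳ _)))
          (+-identityʳ 0#)

  ι-lah-suc : ∀ j k → ι R (lah (suc j) k) ≈ cons 0# (ι R ∘ lah j) k + (ι R j + ι R k) * ι R (lah j k)
  ι-lah-suc j k = begin
    ι R (cons 0 (lah j) k ℕ.+ (j ℕ.+ k) ℕ.* lah j k)
      ≈⟨ ι-+ (cons 0 (lah j) k) ((j ℕ.+ k) ℕ.* lah j k) ⟩
    ι R (cons 0 (lah j) k) + ι R ((j ℕ.+ k) ℕ.* lah j k)
      ≈⟨ +-cong (reflexive (ι-cons (lah j) k)) (trans (ι-* (j ℕ.+ k) (lah j k)) (*-congʳ (ι-+ j k))) ⟩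
    cons 0# (ι R ∘ lah j) k + (ι R j + ι R k) * ι R (lah j k) ∎

  cons-reflect : ∀ n a k → cons 0# (reflect n a) k ≈
                 sumFrom R 0 (suc n) (λ j → sgn R (n ∸ j) * a j * cons 0# (ι R ∘ lah j) k)
  cons-reflect n a zero    = sym (sumFrom-zero (suc n) (λ j → zeroʳ _))
  cons-reflect n a (suc k) = refl

  reflect-+ : ∀ n a b k → reflect n (λ j → a j + b j) k ≈ reflect n a k + reflect n b k
  reflect-+ n a b k = trans (sumFrom-cong (suc n) (λ j → trans (*-congʳ (distribˡ _ _ _)) (distribʳ _ _ _)))
                            (sumFrom-+ (suc n) _ _)

  reflect-suc-cons : ∀ n a k → reflect (suc n) (cons 0# a) k ≈
                     sumFrom R 0 (suc n) (λ j → sgn R (n ∸ j) * a j * ι R (lah (suc j) k))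
  reflect-suc-cons n a k = trans (+-congʳ (trans (*-congʳ (zeroʳ _)) (zeroˡ _)))
                                 (trans (+-identityˡ _) (reflexive (sumFrom-suc 0 (suc n) _)))

  reflect-suc : ∀ n b → b (suc n) ≈ 0# → ∀ k → reflect (suc n) b k ≈
                sumFrom R 0 (suc n) (λ j → (- sgn R (n ∸ j)) * b j * ι R (lah j k))
  reflect-suc n b b₁₊ₙ≈0 k =
    trans (sumFrom-dropLast 0 (suc n) (trans (*-congʳ (trans (*-congˡ b₁₊ₙ≈0) (zeroʳ _))) (zeroˡ _)))
          (sumFrom-cong-≤< (suc n) (λ j _ j≤n → reflexive (≡.cong (λ i → sgn R i * b j * ι R (lah j k))
                                                                  (ℕₚ.+-∸-assoc 1 (ℕₚ.≤-pred j≤n)))))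

  reflect-mulLinear-term : ∀ s x c j k →
    s * x * ι R (lah (suc j) k) + (- s) * ((ι R j + c) * x) * ι R (lah j k) ≈
    s * x * cons 0# (ι R ∘ lah j) k + (ι R k + - c) * (s * x * ι R (lah j k))
  reflect-mulLinear-term s x c j k = begin
    u * ι R (lah (suc j) k) + (- s) * ((J + c) * x) * V
      ≈⟨ +-cong (*-congˡ (ι-lah-suc j k))
                (trans (*-congʳ (sym (-‿distribˡ-* _ _))) (sym (-‿distribˡ-* _ _))) ⟩
    u * (P + (J + K) * V) + - (s * ((J + c) * x) * V)
      ≈⟨ +-cong (trans (distribˡ _ _ _) (+-congˡ (x∙yz≈y∙xz _ _ _)))
                (-‿cong (trans (*-congʳ (x∙yz≈y∙xz _ _ _)) (*-assoc _ _ _))) ⟩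
    (u * P + (J + K) * W) + - ((J + c) * W)
      ≈⟨ +-assoc _ _ _ ⟩
    u * P + ((J + K) * W + - ((J + c) * W))
      ≈⟨ +-congˡ (trans (+-congˡ (-‿distribˡ-* _ _)) (sym (distribʳ _ _ _))) ⟩
    u * P + ((J + K) + - (J + c)) * W
      ≈⟨ +-congˡ (*-congʳ cancel) ⟩
    u * P + (K + - c) * W ∎
    where
    u = s * x
    J = ι R j
    K = ι R k
    P = cons 0# (ι R ∘ lah j) k
    V = ι R (lah j k)
    W = u * V
    cancel : (J + K) + - (J + c) ≈ K + - c
    cancel = trans (+-congˡ (sym (⁻¹-∙-comm J c))) (trans (sym (+-assoc _ _ _)) (+-congʳ (xyx⁻¹≈y J K)))

  reflect-mulLinear : ∀ n c a → a (suc n) ≈ 0# → ∀ k →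
                      reflect (suc n) (mulLinear c a) k ≈ mulLinear (- c) (reflect n a) k
  reflect-mulLinear n c a a₁₊ₙ≈0 k = begin
    reflect (suc n) (mulLinear c a) k
      ≈⟨ reflect-+ (suc n) (cons 0# a) b k ⟩
    reflect (suc n) (cons 0# a) k + reflect (suc n) b k
      ≈⟨ +-cong (reflect-suc-cons n a k) (reflect-suc n b (trans (*-congˡ a₁₊ₙ≈0) (zeroʳ _)) k) ⟩
    sumFrom R 0 (suc n) (λ j → σ j * a j * ι R (lah (suc j) k)) +
    sumFrom R 0 (suc n) (λ j → (- σ j) * b j * L j)
      ≈⟨ sumFrom-+ (suc n) _ _ ⟨
    sumFrom R 0 (suc n) (λ j → σ j * a j * ι R (lah (suc j) k) + (- σ j) * b j * L j)
      ≈⟨ sumFrom-cong (suc n) (λ j → reflect-mulLinear-term (σ j) (a j) c j k) ⟩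
    sumFrom R 0 (suc n) (λ j → σ j * a j * cons 0# (ι R ∘ lah j) k + (ι R k + - c) * (σ j * a j * L j))
      ≈⟨ sumFrom-+ (suc n) _ _ ⟩
    sumFrom R 0 (suc n) (λ j → σ j * a j * cons 0# (ι R ∘ lah j) k) +
    sumFrom R 0 (suc n) (λ j → (ι R k + - c) * (σ j * a j * L j))
      ≈⟨ +-cong (sym (cons-reflect n a k)) (sumFrom-*ˡ (suc n) _ _) ⟩
    cons 0# (reflect n a) k + (ι R k + - c) * reflect n a k ∎
    where
    σ b L : ℕ → Carrier
    σ j = sgn R (n ∸ j)
    b j = (ι R j + c) * a j
    L j = ι R (lah j k)

  dStirling-neg : ∀ μ n k → dStirling R (- μ) n k ≈ reflect n (dStirling R μ n) k
  dStirling-neg μ zero    zero    =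
    sym (trans (+-identityʳ _) (trans (*-cong (*-identityˡ 1#) (+-identityʳ 1#)) (*-identityˡ 1#)))
  dStirling-neg μ zero    (suc k) = sym (trans (+-identityʳ _) (zeroʳ _))
  dStirling-neg μ (suc n) k       = begin
    dStirling R (- μ) (suc n) k
      ≈⟨ dStirling-suc (- μ) n k ⟩
    mulLinear (- (ι R n * - μ)) (dStirling R (- μ) n) k
      ≈⟨ mulLinear-cong (-‿cong (sym (-‿distribʳ-* _ _))) (dStirling-neg μ n) k ⟩
    mulLinear (- - (ι R n * μ)) (reflect n (dStirling R μ n)) k
      ≈⟨ reflect-mulLinear n _ _ (dStirling-above μ (ℕₚ.n<1+n n)) k ⟨
    reflect (suc n) (mulLinear (- (ι R n * μ)) (dStirling R μ n)) k
      ≈⟨ reflect-cong (suc n) (dStirling-suc μ n) k ⟨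
    reflect (suc n) (dStirling R μ (suc n)) k ∎

  factorial*reflect : ∀ {α n} → α ≤ n → ∀ a → ι R (α !) * reflect n a α ≈
    sumFrom R α (suc (n ∸ α)) (λ j → sgn R (n ∸ j) * ι R (j !) * a j * ι R (binomShift j α))
  factorial*reflect {α} {n} α≤n a = begin
    ι R (α !) * reflect n a α                ≈⟨ sumFrom-*ˡ (suc n) (ι R (α !)) _ ⟨
    sumFrom R 0 (suc n) f                    ≡⟨ ≡.cong (λ m → sumFrom R 0 m f) α+[1+n∸α]≡1+n ⟨
    sumFrom R 0 (α ℕ.+ suc (n ∸ α)) f        ≈⟨ sumFrom-dropFirst α vanish ⟩
    sumFrom R α (suc (n ∸ α)) f              ≈⟨ sumFrom-cong-≤< (suc (n ∸ α)) (λ j α≤j _ → closed j α≤j) ⟩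
    sumFrom R α (suc (n ∸ α)) (λ j → sgn R (n ∸ j) * ι R (j !) * a j * ι R (binomShift j α)) ∎
    where
    f : ℕ → Carrier
    f j = ι R (α !) * (sgn R (n ∸ j) * a j * ι R (lah j α))
    α+[1+n∸α]≡1+n : α ℕ.+ suc (n ∸ α) ≡ suc n
    α+[1+n∸α]≡1+n = ≡.trans (ℕₚ.+-suc α (n ∸ α)) (≡.cong suc (ℕₚ.m+[n∸m]≡n α≤n))
    vanish : ∀ j → j ℕ.< α → f j ≈ 0#
    vanish j j<α =
      trans (*-congˡ (trans (*-congˡ (reflexive (≡.cong (ι R) (lah-above j<α)))) (zeroʳ _))) (zeroʳ _)
    closed : ∀ j → α ≤ j → f j ≈ sgn R (n ∸ j) * ι R (j !) * a j * ι R (binomShift j α)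
    closed j α≤j = begin
      ι R (α !) * (s * a j * ι R (lah j α))             ≈⟨ x∙yz≈y∙xz _ _ _ ⟩
      s * a j * (ι R (α !) * ι R (lah j α))             ≈⟨ *-congˡ (ι-* (α !) (lah j α)) ⟨
      s * a j * ι R (α ! ℕ.* lah j α)                   ≡⟨ ≡.cong (λ m → s * a j * ι R m) (lah-closed α≤j) ⟩
      s * a j * ι R (j ! ℕ.* binomShift j α)            ≈⟨ *-congˡ (ι-* (j !) (binomShift j α)) ⟩
      s * a j * (ι R (j !) * ι R (binomShift j α))      ≈⟨ *-interchange _ _ _ _ ⟩
      s * ι R (j !) * (a j * ι R (binomShift j α))      ≈⟨ *-assoc _ _ _ ⟨
      s * ι R (j !) * a j * ι R (binomShift j α)        ∎
      where
      s = sgn R (n ∸ j)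

theorem2p3 : {c ℓ : Level} (R : CommutativeRing c ℓ) →
    let open CommutativeRing R in
    (λ' : Carrier) → ¬ (λ' ≈ 0#) → (α n : ℕ) → α ≤ n →
    ι R (α !) * dStirling R (- λ') n α
      ≈ sumFrom R α (suc (n ∸ α))
          (λ j → sgn R (n ∸ j) * ι R (j !) * dStirling R λ' n j * ι R (binomShift j α))
theorem2p3 R λ' _ α n α≤n = begin
  ι R (α !) * dStirling R (- λ') n α               ≈⟨ *-congˡ (dStirling-neg R λ' n α) ⟩
  ι R (α !) * reflect R n (dStirling R λ' n) α     ≈⟨ factorial*reflect R α≤n (dStirling R λ' n) ⟩
  sumFrom R α (suc (n ∸ α)) (λ j → sgn R (n ∸ j) * ι R (j !) * dStirling R λ' n j * ι R (binomShift j α)) ∎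
  where
  open CommutativeRing R
  open SetoidReasoning setoid
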